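{- Let $n,k,m$ be integers with $2\le k\le n-1$ and $2\le m\le k$, and let $\mathbf a=a_1\cdots a_n$ be a vertex of $G(n)$ contained in at least one closed $k$-walk. Let $y_{\mathbf a}=y_1\cdots y_{n-1}=\mathrm{st}(a_2\cdots a_n)$ and $z_{\mathbf a}=z_1\cdots z_{n-k+1}=\mathrm{st}(a_1\cdots a_{n-k+1})$. Suppose there exist indices $i,j,\ell_1,\dots,\ell_{m-1}$ with $k\le i,j\le n-1$ and $1\le \ell_1,\dots,\ell_{m-1}\le k-1$ such that \[y_i=y_{\ell_1}-1=y_{\ell_2}-2=\cdots=y_{\ell_{m-1}}-(m-1)=y_j-m\] and $z_{i-k+1}+1=z_{n-k+1}=z_{j-k+1}-1$. Then there exist $m$ closed $k$-walks starting at $\mathbf a$ whose second vertices are pairwise distinct.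
   Context: For a sequence of distinct integers $c_1\cdots c_t$, $\mathrm{st}(c_1\cdots c_t)$ is the unique permutation $d_1\cdots d_t$ of $\{1,\dots,t\}$ with $d_i<d_j$ iff $c_i<c_j$. $G(n)$ is the directed multigraph whose vertices are the permutations of $\{1,\dots,n\}$ (one-line notation) and whose edges are the permutations $c_1\cdots c_{n+1}$ of $\{1,\dots,n+1\}$, the edge $c_1\cdots c_{n+1}$ going from $\mathrm{st}(c_1\cdots c_n)$ to $\mathrm{st}(c_2\cdots c_{n+1})$; so there is an edge from $x_1\cdots x_n$ to $w_1\cdots w_n$ iff $\mathrm{st}(x_2\cdots x_n)=\mathrm{st}(w_1\cdots w_{n-1})$. A closed $k$-walk $(v_1,\dots,v_k)$ is a sequence of vertices with an edge from $v_i$ to $v_{i+1}$ for $i<k$ and from $v_k$ to $v_1$. -}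

module Defs where

open import Data.Nat using (ℕ; zero; suc; _<?_)
open import Data.List using (List; []; _∷_; _++_; [_]; map; upTo; length; filter; take; drop)
open import Data.List.Relation.Binary.Permutation.Propositional using (_↭_)
open import Data.List.Relation.Unary.All using (All)
open import Data.Product using (Σ; _×_)
open import Data.Unit using (⊤)
open import Data.Empty using (⊥)
open import Relation.Binary.PropositionalEquality using (_≡_)

IsPerm : ℕ → List ℕ → Set
IsPerm n xs = xs ↭ map suc (upTo n)

rank : List ℕ → ℕ → ℕ
rank xs c = length (filter (_<? c) xs)

-- standardization: st(c₁⋯c_t) = d₁⋯d_t with d_i = 1 + #{j : c_j < c_i}
-- (for distinct entries this is the unique permutation order-isomorphic to c)
st : List ℕ → List ℕ
st xs = map (λ c → suc (rank xs c)) xs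

-- 1-indexed entry x_i (default 0 out of range; only used in range)
_!_ : List ℕ → ℕ → ℕ
[] ! _ = 0
(x ∷ xs) ! zero = 0
(x ∷ xs) ! suc zero = x
(x ∷ xs) ! suc (suc i) = xs ! suc i

Vertex : ℕ → List ℕ → Set
Vertex n = IsPerm n

Edge : ℕ → List ℕ → List ℕ → Set
Edge n x w = Σ (List ℕ) λ c → IsPerm (suc n) c × st (take n c) ≡ x × st (drop 1 c) ≡ w

Path : ℕ → List (List ℕ) → Set
Path n [] = ⊤
Path n (x ∷ []) = ⊤
Path n (x ∷ y ∷ r) = Edge n x y × Path n (y ∷ r)

ClosedPath : ℕ → List (List ℕ) → Set
ClosedPath n [] = ⊥
ClosedPath n (v ∷ vs) = Path n ((v ∷ vs) ++ [ v ])

ClosedWalk : ℕ → ℕ → List (List ℕ) → Set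
ClosedWalk n k ws = length ws ≡ k × All (Vertex n) ws × ClosedPath n ws

module Submission where

-- A sequence c₁⋯c_{n+k} of distinct numbers yields a k-walk whose vertices are its
-- standardized length-n windows; the walk is closed at a when both the first window and
-- the window starting at position k+1 are order-isomorphic to a.  Take
-- c₁⋯cₙ = B·a₁ ⋯ B·aₙ with B = n+1.  Since a lies on a closed k-walk, a_{k+1}⋯aₙ is
-- order-isomorphic to a₁⋯a_{n−k}, so the pairs (a_t, a_{t+k}) form an isotone pattern,
-- and c_{n+1}⋯c_{n+k} can be obtained by interpolating it in base B.  The only freedom
-- is at e = a_{n−k+1}: by the hypothesis on z_a, e is the only letter of a₁⋯a_{n−k+1}
-- between a_{i−k+1} and a_{j−k+1}, whose partners are a_{i+1} and a_{j+1}, so c_{n+1}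
-- may be put just above B·v for any letter v of a₂⋯aₙ with a_{i+1} ≤ v < a_{j+1}.  By
-- the hypothesis on y_a the letters at positions i, ℓ₁, …, ℓ_{m−1} of a₂⋯aₙ are m such
-- choices, and they give second vertices st(c₂⋯c_{n+1}) with different last entries.

open import Defs
open import Data.Nat using (ℕ; zero; suc; _+_; _∸_; _*_; _≤_; _<_; z≤n; s≤s; _<?_; _≤?_; _≟_; _⊔_; _⊓_)
open import Data.Nat.Properties
open import Data.Fin using (Fin; toℕ)
import Data.Fin as Fin
open import Data.Fin.Properties using (toℕ<n; toℕ-injective)
open import Data.List using (List; []; _∷_; _++_; [_]; _∷ʳ_; map; upTo; applyUpTo; length; filter; take; drop; zip)
open import Data.List.Properties
  using ( ∷-injectiveˡ; ∷-injectiveʳ; ∷ʳ-injectiveʳ; ++-assoc; length-++; length-map; length-upTo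
        ; length-take; length-drop; length-filter; map-id; map-∘; map-cong-local; map-++; map-upTo
        ; filter-accept; filter-reject; filter-++; take-map; drop-map; take-take; drop-drop; take-[]
        ; take-all; take++drop≡id )
open import Data.List.Membership.Propositional using (_∈_; _∉_)
open import Data.List.Membership.Propositional.Properties using (∈-map⁺; ∈-map⁻; ∈-upTo⁻; ∈-∃++; ∈-++⁺ʳ)
open import Data.List.Membership.DecPropositional _≟_ using (_∈?_)
open import Data.List.Relation.Unary.All using (All; []; _∷_; tabulate)
import Data.List.Relation.Unary.All.Properties as All
open import Data.List.Relation.Unary.Any using (here; there)
open import Data.List.Relation.Unary.AllPairs using ([]; _∷_)
open import Data.List.Relation.Unary.Unique.Propositional using (Unique)
open import Data.List.Relation.Unary.Unique.Propositional.Properties using (Unique[x∷xs]⇒x∉xs; upTo⁺)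
import Data.List.Relation.Unary.Unique.Propositional.Properties as Unique
open import Data.List.Relation.Binary.Permutation.Propositional
  using (_↭_; ↭-refl; ↭-prep; ↭-swap; ↭-trans; ↭-sym; ↭⇒↭ₛ)
open import Data.List.Relation.Binary.Permutation.Propositional.Properties using (↭-length; filter-↭; ∈-resp-↭)
import Data.List.Relation.Binary.Permutation.Propositional.Properties as ↭
open import Data.List.Relation.Binary.Sublist.Propositional using (lookup)
open import Data.List.Relation.Binary.Sublist.Propositional.Properties using (take-⊆; drop-⊆)
open import Data.Product using (Σ; _×_; _,_; proj₁; proj₂)
open import Data.Unit using (tt)
open import Data.Empty using (⊥; ⊥-elim)
open import Relation.Nullary using (Dec; yes; no; ¬_)
open import Relation.Binary.Definitions using (tri<; tri≈; tri>)
open import Relation.Binary.PropositionalEquality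
  using (_≡_; _≢_; refl; sym; trans; cong; cong₂; subst; subst₂; ≢-sym; module ≡-Reasoning)
  renaming (setoid to ≡-setoid)
open import Data.List.Relation.Binary.Permutation.Setoid.Properties (≡-setoid ℕ) using (Unique-resp-↭)

digits-< : ∀ {B a b c} → a < b → c < B → B * a + c < B * b
digits-< {B} {a} {b} {c} a<b c<B = begin-strict
  B * a + c <⟨ +-monoʳ-< (B * a) c<B ⟩
  B * a + B ≡⟨ +-comm (B * a) B ⟩
  B + B * a ≡⟨ sym (*-suc B a) ⟩
  B * suc a ≤⟨ *-monoʳ-≤ B a<b ⟩
  B * b     ∎
  where open ≤-Reasoning

digits-≢ : ∀ {B a b c} → 0 < c → c < B → B * a + c ≢ B * b
digits-≢ {B} {a} {b} {c} 0<c c<B eq with a <? b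
... | yes a<b = <-irrefl eq (digits-< a<b c<B)
... | no a≮b = <-irrefl (sym eq) (≤-<-trans (*-monoʳ-≤ B (≮⇒≥ a≮b)) (m<m+n (B * a) 0<c))

≤∸1⇒< : ∀ {t n} → 0 < t → t ≤ n ∸ 1 → t < n
≤∸1⇒< {n = zero} (s≤s _) ()
≤∸1⇒< {n = suc n} _ t≤n = s≤s t≤n

m+1+n≤1+o⇒m+n≤o : ∀ n t {m} → n + suc t ≤ suc m → n + t ≤ m
m+1+n≤1+o⇒m+n≤o n t {m} le = ≤-pred (subst (_≤ suc m) (+-suc n t) le)

rank-< : ∀ {x c} xs → x < c → rank (x ∷ xs) c ≡ suc (rank xs c)
rank-< {c = c} xs x<c = cong length (filter-accept (_<? c) x<c)

rank-≥ : ∀ {x c} xs → c ≤ x → rank (x ∷ xs) c ≡ rank xs c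
rank-≥ {c = c} xs c≤x = cong length (filter-reject (_<? c) (≤⇒≯ c≤x))

rank-mono-≤ : ∀ xs {c d} → c ≤ d → rank xs c ≤ rank xs d
rank-mono-≤ [] _ = z≤n
rank-mono-≤ (x ∷ xs) {c} {d} c≤d with x <? c | x <? d
... | yes x<c | _ rewrite rank-< xs x<c | rank-< xs (<-≤-trans x<c c≤d) = s≤s (rank-mono-≤ xs c≤d)
... | no x≮c | yes x<d rewrite rank-≥ xs (≮⇒≥ x≮c) | rank-< xs x<d = m≤n⇒m≤1+n (rank-mono-≤ xs c≤d)
... | no x≮c | no x≮d rewrite rank-≥ xs (≮⇒≥ x≮c) | rank-≥ xs (≮⇒≥ x≮d) = rank-mono-≤ xs c≤d

rank-mono-<-∈ : ∀ {xs x y} → x ∈ xs → x < y → rank xs x < rank xs y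
rank-mono-<-∈ {x ∷ xs} (here refl) x<y
  rewrite rank-≥ {x} xs ≤-refl | rank-< xs x<y = s≤s (rank-mono-≤ xs (<⇒≤ x<y))
rank-mono-<-∈ {z ∷ xs} {x} {y} (there x∈xs) x<y with z <? x | z <? y
... | yes z<x | _ rewrite rank-< xs z<x | rank-< xs (<-trans z<x x<y) = s≤s (rank-mono-<-∈ x∈xs x<y)
... | no z≮x | yes z<y rewrite rank-≥ xs (≮⇒≥ z≮x) | rank-< xs z<y = m≤n⇒m≤1+n (rank-mono-<-∈ x∈xs x<y)
... | no z≮x | no z≮y rewrite rank-≥ xs (≮⇒≥ z≮x) | rank-≥ xs (≮⇒≥ z≮y) = rank-mono-<-∈ x∈xs x<y

rank-reflects-< : ∀ xs {x y} → rank xs x < rank xs y → x < y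
rank-reflects-< xs {x} {y} r with x <? y
... | yes x<y = x<y
... | no x≮y = ⊥-elim (<⇒≱ r (rank-mono-≤ xs (≮⇒≥ x≮y)))

rank-reflects-≤ : ∀ {xs x y} → y ∈ xs → rank xs x ≤ rank xs y → x ≤ y
rank-reflects-≤ {xs} {x} {y} y∈xs r with y <? x
... | yes y<x = ⊥-elim (<⇒≱ (rank-mono-<-∈ y∈xs y<x) r)
... | no y≮x = ≮⇒≥ y≮x

rank-↭ : ∀ {xs ys} c → xs ↭ ys → rank xs c ≡ rank ys c
rank-↭ c xs↭ys = ↭-length (filter-↭ (_<? c) xs↭ys)

rank-++ : ∀ xs ys c → rank (xs ++ ys) c ≡ rank xs c + rank ys c
rank-++ xs ys c = trans (cong length (filter-++ (_<? c) xs ys)) (length-++ (filter (_<? c) xs))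

rank-≤-length : ∀ xs c → rank xs c ≤ length xs
rank-≤-length xs c = length-filter (_<? c) xs

rank-map : ∀ {f : ℕ → ℕ} {c d} xs → (∀ {x} → x ∈ xs → (x < c → f x < d) × (f x < d → x < c)) →
           rank (map f xs) d ≡ rank xs c
rank-map [] _ = refl
rank-map {f} {c} {d} (x ∷ xs) iff with x <? c
... | yes x<c rewrite rank-< (map f xs) (proj₁ (iff (here refl)) x<c) | rank-< xs x<c =
  cong suc (rank-map xs (λ x∈ → iff (there x∈)))
... | no x≮c rewrite rank-≥ (map f xs) (≮⇒≥ (λ fx<d → x≮c (proj₂ (iff (here refl)) fx<d)))
                  | rank-≥ xs (≮⇒≥ x≮c) =
  rank-map xs (λ x∈ → iff (there x∈))

rank-consecutive : ∀ {xs x y w} → x ∈ xs → w ∈ xs → rank xs y ≡ suc (rank xs x) → x < w → w < y → ⊥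
rank-consecutive x∈ w∈ ry≡ x<w w<y =
  <⇒≱ (rank-mono-<-∈ x∈ x<w) (≤-pred (subst (_ <_) ry≡ (rank-mono-<-∈ w∈ w<y)))

rank-digits : ∀ {B v c} xs → 0 < c → c < B → rank (map (B *_) xs) (B * v + c) ≡ rank xs (suc v)
rank-digits {B} {v} {c} xs 0<c c<B = rank-map xs (λ _ → to , from)
  where
  to : ∀ {x} → x < suc v → B * x < B * v + c
  to x<1+v = ≤-<-trans (*-monoʳ-≤ B (≤-pred x<1+v)) (m<m+n (B * v) 0<c)
  from : ∀ {x} → B * x < B * v + c → x < suc v
  from {x} Bx< = s≤s (≮⇒≥ (λ v<x → <-asym Bx< (digits-< v<x c<B)))

-- Standardization and order-preserving maps

StrictlyIncreasingOn : List ℕ → (ℕ → ℕ) → Set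
StrictlyIncreasingOn xs f = ∀ {x y} → x ∈ xs → y ∈ xs → x < y → f x < f y

module _ {xs : List ℕ} {f : ℕ → ℕ} (inc : StrictlyIncreasingOn xs f) where

  increasingOn-reflects-< : ∀ {x y} → x ∈ xs → y ∈ xs → f x < f y → x < y
  increasingOn-reflects-< {x} {y} x∈ y∈ fx<fy with <-cmp x y
  ... | tri< x<y _ _ = x<y
  ... | tri≈ _ refl _ = ⊥-elim (<-irrefl refl fx<fy)
  ... | tri> _ _ y<x = ⊥-elim (<-asym fx<fy (inc y∈ x∈ y<x))

  increasingOn-injective : ∀ {x y} → x ∈ xs → y ∈ xs → f x ≡ f y → x ≡ y
  increasingOn-injective {x} {y} x∈ y∈ fx≡fy with <-cmp x y
  ... | tri< x<y _ _ = ⊥-elim (<-irrefl fx≡fy (inc x∈ y∈ x<y))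
  ... | tri≈ _ x≡y _ = x≡y
  ... | tri> _ _ y<x = ⊥-elim (<-irrefl (sym fx≡fy) (inc y∈ x∈ y<x))

  increasingOn-⊆ : ∀ {ys} → (∀ {x} → x ∈ ys → x ∈ xs) → StrictlyIncreasingOn ys f
  increasingOn-⊆ ys⊆xs x∈ y∈ = inc (ys⊆xs x∈) (ys⊆xs y∈)

  st-map : st (map f xs) ≡ st xs
  st-map = begin
    map (λ c → suc (rank (map f xs) c)) (map f xs) ≡⟨ sym (map-∘ xs) ⟩
    map (λ x → suc (rank (map f xs) (f x))) xs     ≡⟨ map-cong-local (tabulate (λ x∈ → cong suc (rank-map xs (iff x∈)))) ⟩
    map (λ x → suc (rank xs x)) xs                 ∎
    where
    open ≡-Reasoning
    iff : ∀ {x y} → x ∈ xs → y ∈ xs → (y < x → f y < f x) × (f y < f x → y < x)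
    iff x∈ y∈ = inc y∈ x∈ , increasingOn-reflects-< y∈ x∈

unique-map : ∀ {xs f} → StrictlyIncreasingOn xs f → Unique xs → Unique (map f xs)
unique-map _ [] = []
unique-map {x ∷ xs} {f} inc u@(_ ∷ uxs) =
  All.map⁺ {P = f x ≢_} (tabulate fx≢) ∷ unique-map (increasingOn-⊆ inc {xs} there) uxs
  where
  fx≢ : ∀ {y} → y ∈ xs → f x ≢ f y
  fx≢ y∈ fx≡fy = Unique[x∷xs]⇒x∉xs u (subst (_∈ xs) (sym (increasingOn-injective inc (here refl) (there y∈) fx≡fy)) y∈)

st-increasing : ∀ L → StrictlyIncreasingOn L (λ c → suc (rank L c))
st-increasing L x∈ _ x<y = s≤s (rank-mono-<-∈ x∈ x<y)

rank-suc-increasing : ∀ xs → StrictlyIncreasingOn xs (λ x → rank xs (suc x))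
rank-suc-increasing xs _ y∈ x<y = ≤-<-trans (rank-mono-≤ xs x<y) (rank-mono-<-∈ y∈ (n<1+n _))

st-take-st : ∀ q L → st (take q (st L)) ≡ st (take q L)
st-take-st q L = trans (cong st (take-map q L)) (st-map (increasingOn-⊆ (st-increasing L) (lookup (take-⊆ q L))))

st-drop-st : ∀ q L → st (drop q (st L)) ≡ st (drop q L)
st-drop-st q L = trans (cong st (drop-map q L)) (st-map (increasingOn-⊆ (st-increasing L) (lookup (drop-⊆ q L))))

st-∷ʳ : ∀ xs w → st (xs ∷ʳ w) ≡ map (λ c → suc (rank (xs ∷ʳ w) c)) xs ∷ʳ suc (rank xs w)
st-∷ʳ xs w = trans (map-++ (λ c → suc (rank (xs ∷ʳ w) c)) xs [ w ])
  (cong (λ r → map (λ c → suc (rank (xs ∷ʳ w) c)) xs ∷ʳ suc r)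
        (trans (rank-++ xs [ w ] w) (trans (cong (rank xs w +_) (rank-≥ {w} [] ≤-refl)) (+-identityʳ _))))

-- Permutations of 1, …, n

range : ℕ → ℕ → List ℕ
range s zero = []
range s (suc n) = s ∷ range (suc s) n

applyUpTo-range : ∀ f s n → (∀ i → f i ≡ s + i) → applyUpTo f n ≡ range s n
applyUpTo-range f s zero _ = refl
applyUpTo-range f s (suc n) f≗s+ =
  cong₂ _∷_ (trans (f≗s+ 0) (+-identityʳ s))
            (applyUpTo-range (λ i → f (suc i)) (suc s) n (λ i → trans (f≗s+ (suc i)) (+-suc s i)))

upTo-range : ∀ n → map suc (upTo n) ≡ range 1 n
upTo-range n = trans (map-upTo suc n) (applyUpTo-range suc 1 n (λ _ → refl))

rank-range-≤ : ∀ {s c} n → c ≤ s → rank (range s n) c ≡ 0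
rank-range-≤ zero _ = refl
rank-range-≤ {s} (suc n) c≤s = trans (rank-≥ (range (suc s) n) c≤s) (rank-range-≤ n (m≤n⇒m≤1+n c≤s))

rank-range : ∀ {s c} n → s ≤ c → c ≤ s + n → rank (range s n) c + s ≡ c
rank-range {s} {c} zero s≤c c≤s+0 = ≤-antisym s≤c (subst (c ≤_) (+-identityʳ s) c≤s+0)
rank-range {s} {c} (suc n) s≤c c≤s+n with s <? c
... | yes s<c rewrite rank-< (range (suc s) n) s<c =
  trans (sym (+-suc _ s)) (rank-range n s<c (subst (c ≤_) (+-suc s n) c≤s+n))
... | no s≮c rewrite rank-≥ (range (suc s) n) (≮⇒≥ s≮c) | rank-range-≤ {suc s} n (m≤n⇒m≤1+n (≮⇒≥ s≮c)) =
  ≤-antisym s≤c (≮⇒≥ s≮c)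

bump : ℕ → ℕ → ℕ
bump r v with v ≤? r
... | yes _ = v
... | no _ = suc v

bump-≤ : ∀ {r v} → v ≤ r → bump r v ≡ v
bump-≤ {r} {v} v≤r with v ≤? r
... | yes _ = refl
... | no v≰r = ⊥-elim (v≰r v≤r)

bump-> : ∀ {r v} → r < v → bump r v ≡ suc v
bump-> {r} {v} r<v with v ≤? r
... | yes v≤r = ⊥-elim (<⇒≱ r<v v≤r)
... | no _ = refl

map-bump-range : ∀ {r} s n → r < s → map (bump r) (range s n) ≡ range (suc s) n
map-bump-range s zero _ = refl
map-bump-range s (suc n) r<s = cong₂ _∷_ (bump-> r<s) (map-bump-range (suc s) n (m≤n⇒m≤1+n r<s))

insert-range : ∀ s n r → s ≤ suc r → suc r ≤ s + n → (suc r ∷ map (bump r) (range s n)) ↭ range s (suc n)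
insert-range s n r s≤1+r 1+r≤s+n with s ≤? r
insert-range s zero r _ 1+r≤s+0 | yes s≤r = ⊥-elim (<⇒≱ (s≤s s≤r) (subst (suc r ≤_) (+-identityʳ s) 1+r≤s+0))
insert-range s (suc n) r _ 1+r≤s+n | yes s≤r rewrite bump-≤ s≤r =
  ↭-trans (↭-swap (suc r) s ↭-refl) (↭-prep s (insert-range (suc s) n r (s≤s s≤r) (subst (suc r ≤_) (+-suc s n) 1+r≤s+n)))
insert-range s n r s≤1+r _ | no s≰r with ≤-antisym s≤1+r (≰⇒> s≰r)
... | refl rewrite map-bump-range {r} (suc r) n ≤-refl = ↭-refl

st-∷ : ∀ {x L} → x ∉ L → st (x ∷ L) ≡ suc (rank L x) ∷ map (bump (rank L x)) (st L)
st-∷ {x} {L} x∉L = cong₂ _∷_ (cong suc (rank-≥ L ≤-refl))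
  (trans (map-cong-local (tabulate entry)) (map-∘ L))
  where
  entry : ∀ {c} → c ∈ L → suc (rank (x ∷ L) c) ≡ bump (rank L x) (suc (rank L c))
  entry {c} c∈L with <-cmp x c
  ... | tri< x<c _ _ rewrite rank-< L x<c = sym (bump-> (s≤s (rank-mono-≤ L (<⇒≤ x<c))))
  ... | tri≈ _ refl _ = ⊥-elim (x∉L c∈L)
  ... | tri> _ _ c<x rewrite rank-≥ L (<⇒≤ c<x) = sym (bump-≤ (rank-mono-<-∈ c∈L c<x))

st-↭-range : ∀ {L} → Unique L → st L ↭ range 1 (length L)
st-↭-range {[]} _ = ↭-refl
st-↭-range {x ∷ L} (x≢ ∷ uL) rewrite st-∷ (Unique[x∷xs]⇒x∉xs (x≢ ∷ uL)) =
  ↭-trans (↭-prep _ (↭.map⁺ (bump (rank L x)) (st-↭-range uL)))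
          (insert-range 1 (length L) (rank L x) (s≤s z≤n) (s≤s (rank-≤-length L x)))

st-isPerm : ∀ {n L} → Unique L → length L ≡ n → IsPerm n (st L)
st-isPerm {n} {L} uL refl = subst (st L ↭_) (sym (upTo-range n)) (st-↭-range uL)

module _ {n xs} (perm : IsPerm n xs) where

  perm-length : length xs ≡ n
  perm-length = trans (↭-length perm) (trans (length-map suc (upTo n)) (length-upTo n))

  perm-unique : Unique xs
  perm-unique = Unique-resp-↭ (↭⇒↭ₛ (↭-sym perm)) (Unique.map⁺ suc-injective (upTo⁺ n))

  perm-∈ : ∀ {x} → x ∈ xs → 0 < x × x < suc n
  perm-∈ x∈ with ∈-map⁻ suc (∈-resp-↭ perm x∈)
  ... | y , y∈ , refl = s≤s z≤n , s≤s (∈-upTo⁻ y∈)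

  st-perm : st xs ≡ xs
  st-perm = trans (map-cong-local (tabulate rank-suc)) (map-id xs)
    where
    rank-suc : ∀ {c} → c ∈ xs → suc (rank xs c) ≡ c
    rank-suc {c} c∈ = begin
      suc (rank xs c)          ≡⟨ cong suc (rank-↭ c (subst (xs ↭_) (upTo-range n) perm)) ⟩
      suc (rank (range 1 n) c) ≡⟨ +-comm 1 _ ⟩
      rank (range 1 n) c + 1   ≡⟨ rank-range n (proj₁ (perm-∈ c∈)) (<⇒≤ (proj₂ (perm-∈ c∈))) ⟩
      c                        ∎
      where open ≡-Reasoning

unique-++-disjoint : ∀ (xs : List ℕ) {ys x} → Unique (xs ++ ys) → x ∈ xs → x ∉ ys
unique-++-disjoint (x ∷ xs) u (here refl) x∈ys = Unique[x∷xs]⇒x∉xs u (∈-++⁺ʳ xs x∈ys)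
unique-++-disjoint (_ ∷ xs) (_ ∷ u) (there x∈) = unique-++-disjoint xs u x∈

take-++-length : ∀ (xs ys : List ℕ) → take (length xs) (xs ++ ys) ≡ xs
take-++-length [] ys = refl
take-++-length (x ∷ xs) ys = cong (x ∷_) (take-++-length xs ys)

take-suc-++ : ∀ (xs : List ℕ) y ys → take (suc (length xs)) (xs ++ y ∷ ys) ≡ xs ∷ʳ y
take-suc-++ [] y ys = refl
take-suc-++ (x ∷ xs) y ys = cong (x ∷_) (take-suc-++ xs y ys)

drop-++-≤ : ∀ d (xs ys : List ℕ) → d ≤ length xs → drop d (xs ++ ys) ≡ drop d xs ++ ys
drop-++-≤ zero xs ys _ = refl
drop-++-≤ (suc d) (x ∷ xs) ys (s≤s d≤) = drop-++-≤ d xs ys d≤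

drop-! : ∀ d L → d < length L → drop d L ≡ L ! suc d ∷ drop (suc d) L
drop-! zero (x ∷ L) _ = refl
drop-! (suc d) (x ∷ L) (s≤s d<L) = drop-! d L d<L

!-∈ : ∀ L {t} → 1 ≤ t → t ≤ length L → L ! t ∈ L
!-∈ (x ∷ L) {suc zero} _ _ = here refl
!-∈ (x ∷ L) {suc (suc t)} _ (s≤s t≤) = there (!-∈ L (s≤s z≤n) t≤)

!-map : ∀ (f : ℕ → ℕ) L {t} → 1 ≤ t → t ≤ length L → map f L ! t ≡ f (L ! t)
!-map f (x ∷ L) {suc zero} _ _ = refl
!-map f (x ∷ L) {suc (suc t)} _ (s≤s t≤) = !-map f L (s≤s z≤n) t≤

!-take : ∀ q L {t} → 1 ≤ t → t ≤ q → take q L ! t ≡ L ! t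
!-take zero L (s≤s _) ()
!-take (suc q) [] _ _ = refl
!-take (suc q) (x ∷ L) {suc zero} _ _ = refl
!-take (suc q) (x ∷ L) {suc (suc t)} _ (s≤s t≤q) = !-take q L (s≤s z≤n) t≤q

!-drop : ∀ d L {t} → 1 ≤ t → drop d L ! t ≡ L ! (d + t)
!-drop zero L _ = refl
!-drop (suc d) [] _ = refl
!-drop (suc d) (x ∷ L) {suc t} _ rewrite +-suc d t = trans (!-drop d L (s≤s z≤n)) (cong (L !_) (+-suc d t))

!-zip : ∀ X Y {t} → 1 ≤ t → t ≤ length X → t ≤ length Y → (X ! t , Y ! t) ∈ zip X Y
!-zip (x ∷ X) (w ∷ Y) {suc zero} _ _ _ = here refl
!-zip (x ∷ X) (w ∷ Y) {suc (suc t)} _ (s≤s t≤X) (s≤s t≤Y) = there (!-zip X Y (s≤s z≤n) t≤X t≤Y)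

st-! : ∀ L {t} → 1 ≤ t → t ≤ length L → st L ! t ≡ suc (rank L (L ! t))
st-! L = !-map (λ c → suc (rank L c)) L

-- Walks read off a sequence

vertex-window : ∀ {n s} → Unique s → n ≤ length s → Vertex n (st (take n s))
vertex-window {n} {s} us n≤ = st-isPerm (Unique.take⁺ n us) (trans (length-take n s) (m≤n⇒m⊓n≡m n≤))

edge-window : ∀ {n x xs} → Unique (x ∷ xs) → n ≤ length xs → Edge n (st (take n (x ∷ xs))) (st (take n xs))
edge-window {n} {x} {xs} us n≤ =
  st (take (suc n) (x ∷ xs)) ,
  vertex-window us (s≤s n≤) ,
  trans (st-take-st n (take (suc n) (x ∷ xs)))
    (cong st (trans (take-take n (suc n) (x ∷ xs)) (cong (λ m → take m (x ∷ xs)) (m≤n⇒m⊓n≡m (n≤1+n n))))) ,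
  st-drop-st 1 (take (suc n) (x ∷ xs))

windows : ℕ → List ℕ → ℕ → List (List ℕ)
windows n s zero = []
windows n s (suc t) = st (take n s) ∷ windows n (drop 1 s) t

length-windows : ∀ n s t → length (windows n s t) ≡ t
length-windows n s zero = refl
length-windows n s (suc t) = cong suc (length-windows n (drop 1 s) t)

all-windows : ∀ {n} t s → Unique s → n + t ≤ length s → All (Vertex n) (windows n s t)
all-windows zero s _ _ = []
all-windows {n} (suc t) [] _ n+t≤0 = ⊥-elim (<⇒≱ (s≤s z≤n) (≤-trans (m≤n+m (suc t) n) n+t≤0))
all-windows {n} (suc t) (x ∷ xs) us@(_ ∷ uxs) n+t≤ =
  vertex-window us (≤-trans (m≤m+n n (suc t)) n+t≤) ∷ all-windows t xs uxs (m+1+n≤1+o⇒m+n≤o n t n+t≤)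

path-windows : ∀ {n} t s → Unique s → n + t ≤ length s → Path n (windows n s t ++ [ st (take n (drop t s)) ])
path-windows zero s _ _ = tt
path-windows {n} (suc t) [] _ n+t≤0 = ⊥-elim (<⇒≱ (s≤s z≤n) (≤-trans (m≤n+m (suc t) n) n+t≤0))
path-windows {n} (suc zero) (x ∷ xs) us n+1≤ = edge-window us (≤-trans (m≤m+n n 0) (m+1+n≤1+o⇒m+n≤o n 0 n+1≤)) , tt
path-windows {n} (suc (suc t)) (x ∷ xs) us@(_ ∷ uxs) n+t≤ =
  edge-window us (≤-trans (m≤m+n n (suc t)) n+t≤xs) , path-windows (suc t) xs uxs n+t≤xs
  where
  n+t≤xs : n + suc t ≤ length xs
  n+t≤xs = m+1+n≤1+o⇒m+n≤o n (suc t) n+t≤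

closedWalk-windows : ∀ {n k a s} → 0 < k → Unique s → n + k ≤ length s →
                     st (take n s) ≡ a → st (take n (drop k s)) ≡ a →
                     ClosedWalk n k (a ∷ windows n (drop 1 s) (k ∸ 1))
closedWalk-windows {n} {suc k} {a} {s} _ us n+k≤ st₀ stₖ =
  cong suc (length-windows n (drop 1 s) k) ,
  subst (λ v → All (Vertex n) (v ∷ windows n (drop 1 s) k)) st₀ (all-windows (suc k) s us n+k≤) ,
  subst₂ (λ u w → Path n (u ∷ windows n (drop 1 s) k ++ [ w ])) st₀ stₖ (path-windows (suc k) s us n+k≤)

-- Along a walk of length t from x to w the last n ∸ t letters of x are
-- order-isomorphic to the first n ∸ t letters of w.
Overlap : ℕ → ℕ → List ℕ → List ℕ → Set
Overlap n t x w = st (drop t x) ≡ st (take (n ∸ t) w)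

drop-take : ∀ t q (L : List ℕ) → drop t (take q L) ≡ take (q ∸ t) (drop t L)
drop-take zero q L = refl
drop-take (suc t) zero L = refl
drop-take (suc t) (suc q) [] = sym (take-[] (q ∸ t))
drop-take (suc t) (suc q) (x ∷ L) = drop-take t q L

edge-overlap : ∀ {n x w} → Edge n x w → Overlap n 1 x w
edge-overlap {n} (c , _ , refl , refl) = begin
  st (drop 1 (st (take n c)))       ≡⟨ st-drop-st 1 (take n c) ⟩
  st (drop 1 (take n c))            ≡⟨ cong st (drop-take 1 n c) ⟩
  st (take (n ∸ 1) (drop 1 c))      ≡⟨ sym (st-take-st (n ∸ 1) (drop 1 c)) ⟩
  st (take (n ∸ 1) (st (drop 1 c))) ∎
  where open ≡-Reasoning

overlap-trans : ∀ {n s t x y w} → Overlap n s x y → Overlap n t y w → Overlap n (s + t) x w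
overlap-trans {n} {s} {t} {x} {y} {w} xy yw = begin
  st (drop (s + t) x)                       ≡⟨ cong st (sym (drop-drop s t x)) ⟩
  st (drop t (drop s x))                    ≡⟨ sym (st-drop-st t (drop s x)) ⟩
  st (drop t (st (drop s x)))               ≡⟨ cong (λ z → st (drop t z)) xy ⟩
  st (drop t (st (take (n ∸ s) y)))         ≡⟨ st-drop-st t (take (n ∸ s) y) ⟩
  st (drop t (take (n ∸ s) y))              ≡⟨ cong st (drop-take t (n ∸ s) y) ⟩
  st (take (n ∸ s ∸ t) (drop t y))          ≡⟨ sym (st-take-st (n ∸ s ∸ t) (drop t y)) ⟩
  st (take (n ∸ s ∸ t) (st (drop t y)))     ≡⟨ cong (λ z → st (take (n ∸ s ∸ t) z)) yw ⟩
  st (take (n ∸ s ∸ t) (st (take (n ∸ t) w))) ≡⟨ st-take-st (n ∸ s ∸ t) (take (n ∸ t) w) ⟩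
  st (take (n ∸ s ∸ t) (take (n ∸ t) w))    ≡⟨ cong st (take-take (n ∸ s ∸ t) (n ∸ t) w) ⟩
  st (take ((n ∸ s ∸ t) ⊓ (n ∸ t)) w)       ≡⟨ cong (λ m → st (take m w)) (m≤n⇒m⊓n≡m (∸-monoˡ-≤ t (m∸n≤m n s))) ⟩
  st (take (n ∸ s ∸ t) w)                   ≡⟨ cong (λ m → st (take m w)) (∸-+-assoc n s t) ⟩
  st (take (n ∸ (s + t)) w)                 ∎
  where open ≡-Reasoning

path-overlap : ∀ {n} x vs w → Path n (x ∷ vs ++ [ w ]) → Overlap n (suc (length vs)) x w
path-overlap x [] w (e , _) = edge-overlap e
path-overlap {n} x (v ∷ vs) w (e , p) = overlap-trans {n} {1} {suc (length vs)} {x} {v} {w} (edge-overlap e) (path-overlap v vs w p)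

path-split : ∀ {n} xs y ys → Path n (xs ++ y ∷ ys) → Path n (xs ++ [ y ]) × Path n (y ∷ ys)
path-split [] y ys p = tt , p
path-split (x ∷ []) y ys (e , p) = (e , tt) , p
path-split (x ∷ x′ ∷ xs) y ys (e , p) with path-split (x′ ∷ xs) y ys p
... | p₁ , p₂ = (e , p₁) , p₂

closedWalk-overlap : ∀ {n k a ws} → ClosedWalk n k ws → a ∈ ws → Overlap n k a a
closedWalk-overlap {n} {a = a} (refl , _ , cp) a∈ws with ∈-∃++ a∈ws
... | [] , post , refl = path-overlap a post a cp
... | v ∷ pre , post , refl with path-split (v ∷ pre) a (post ++ [ v ]) (subst (Path n) (++-assoc (v ∷ pre) (a ∷ post) [ v ]) cp)
...   | pre-path , post-path =
  subst (λ t → Overlap n t a a) (trans (+-comm (suc (length post)) (suc (length pre))) (sym (length-++ (v ∷ pre))))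
    (overlap-trans {n} {suc (length post)} {suc (length pre)} {a} {v} {a} (path-overlap a post v post-path) (path-overlap v pre a pre-path))

-- Interpolating an isotone pattern

IsotonePairs : List (ℕ × ℕ) → Set
IsotonePairs P = ∀ {y z y′ z′} → (y , z) ∈ P → (y′ , z′) ∈ P → (y < y′ → z < z′) × (z < z′ → y < y′)

isotone-≤ : ∀ {P} → IsotonePairs P → ∀ {y z y′ z′} → (y , z) ∈ P → (y′ , z′) ∈ P → y ≤ y′ → z ≤ z′
isotone-≤ iso p p′ y≤y′ = ≮⇒≥ (λ z′<z → <⇒≱ (proj₂ (iso p′ p) z′<z) y≤y′)

zip-∈ : ∀ {X Y : List ℕ} {y z} → (y , z) ∈ zip X Y → y ∈ X × z ∈ Y
zip-∈ {x ∷ X} {w ∷ Y} (here refl) = here refl , here refl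
zip-∈ {x ∷ X} {w ∷ Y} (there p) = let y∈ , z∈ = zip-∈ p in there y∈ , there z∈

zip-∈-map≡ : ∀ {f g : ℕ → ℕ} X Y → map f X ≡ map g Y → ∀ {y z} → (y , z) ∈ zip X Y → f y ≡ g z
zip-∈-map≡ (x ∷ X) (w ∷ Y) fX≡gY (here refl) = ∷-injectiveˡ fX≡gY
zip-∈-map≡ (x ∷ X) (w ∷ Y) fX≡gY (there p) = zip-∈-map≡ X Y (∷-injectiveʳ fX≡gY) p

zip-map≡ : ∀ {f g : ℕ → ℕ} X Y → length X ≡ length Y →
           (∀ {y z} → (y , z) ∈ zip X Y → f y ≡ g z) → map f X ≡ map g Y
zip-map≡ [] [] _ _ = refl
zip-map≡ (x ∷ X) (w ∷ Y) |X|≡|Y| f≡g =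
  cong₂ _∷_ (f≡g (here refl)) (zip-map≡ X Y (suc-injective |X|≡|Y|) (λ p → f≡g (there p)))

isotone-zip : ∀ {X Y} → st X ≡ st Y → IsotonePairs (zip X Y)
isotone-zip {X} {Y} stX≡stY p p′ =
  (λ y<y′ → rank-reflects-< Y (subst₂ _<_ (rank≡ p) (rank≡ p′) (rank-mono-<-∈ (proj₁ (zip-∈ p)) y<y′))) ,
  (λ z<z′ → rank-reflects-< X (subst₂ _<_ (sym (rank≡ p)) (sym (rank≡ p′)) (rank-mono-<-∈ (proj₂ (zip-∈ p)) z<z′)))
  where
  rank≡ : ∀ {y z} → (y , z) ∈ zip X Y → rank X y ≡ rank Y z
  rank≡ p = suc-injective (zip-∈-map≡ X Y stX≡stY p)

step : List (ℕ × ℕ) → ℕ → ℕ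
step [] x = 0
step ((y , z) ∷ P) x with y ≤? x
... | yes _ = z ⊔ step P x
... | no _ = step P x

step-≥ : ∀ {P y z x} → (y , z) ∈ P → y ≤ x → z ≤ step P x
step-≥ {(y , z) ∷ P} {x = x} (here refl) y≤x with y ≤? x
... | yes _ = m≤m⊔n z (step P x)
... | no y≰x = ⊥-elim (y≰x y≤x)
step-≥ {(y′ , z′) ∷ P} {x = x} (there p) y≤x with y′ ≤? x
... | yes _ = ≤-trans (step-≥ {P} p y≤x) (m≤n⊔m z′ (step P x))
... | no _ = step-≥ {P} p y≤x

step-≤ : ∀ {P x c} → (∀ {y z} → (y , z) ∈ P → y ≤ x → z ≤ c) → step P x ≤ c
step-≤ {[]} _ = z≤n
step-≤ {(y , z) ∷ P} {x} bound with y ≤? x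
... | yes y≤x = ⊔-lub (bound (here refl) y≤x) (step-≤ {P} (λ p → bound (there p)))
... | no _ = step-≤ {P} (λ p → bound (there p))

step-< : ∀ {P x c} → 0 < c → (∀ {y z} → (y , z) ∈ P → y ≤ x → z < c) → step P x < c
step-< {P} {c = suc c} _ bound = s≤s (step-≤ {P} (λ p y≤x → ≤-pred (bound p y≤x)))

step-mono : ∀ {P x x′} → x ≤ x′ → step P x ≤ step P x′
step-mono {P} x≤x′ = step-≤ {P} (λ p y≤x → step-≥ {P} p (≤-trans y≤x x≤x′))

module Insertion (P : List (ℕ × ℕ)) (iso : IsotonePairs P) (pos : ∀ {y z} → (y , z) ∈ P → 0 < z)
  {e v : ℕ} (e∉ : e ∉ map proj₁ P)
  (below : ∀ {y z} → (y , z) ∈ P → y < e → z ≤ v)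
  (above : ∀ {y z} → (y , z) ∈ P → e < y → v < z)
  (B : ℕ) where

  -- lift x is the two-digit base-B number (h x , offset x), where h interpolates P with (e , v)
  -- inserted.  The first coordinates of P go exactly to B times their partners; every other
  -- point keeps itself as lower digit, which separates it from points with the same h-value.

  h : ℕ → ℕ
  h = step ((e , v) ∷ P)

  offset : ℕ → ℕ
  offset x with x ∈? map proj₁ P
  ... | yes _ = 0
  ... | no _ = x

  lift : ℕ → ℕ
  lift x = B * h x + offset x

  private
    pair≢e : ∀ {y z} → (y , z) ∈ P → y ≢ e
    pair≢e p refl = e∉ (∈-map⁺ proj₁ p)

  h-pair : ∀ {y z} → (y , z) ∈ P → h y ≡ z
  h-pair {y} {z} p = ≤-antisym (step-≤ {(e , v) ∷ P} bound) (step-≥ {(e , v) ∷ P} (there p) ≤-refl)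
    where
    bound : ∀ {y′ z′} → (y′ , z′) ∈ (e , v) ∷ P → y′ ≤ y → z′ ≤ z
    bound (here refl) e≤y = <⇒≤ (above p (≤∧≢⇒< e≤y (≢-sym (pair≢e p))))
    bound (there p′) y′≤y = isotone-≤ iso p′ p y′≤y

  h-<-pair : ∀ {x y z} → (y , z) ∈ P → x < y → h x < z
  h-<-pair p x<y = step-< {(e , v) ∷ P} (pos p) bound
    where
    bound : ∀ {y′ z′} → (y′ , z′) ∈ (e , v) ∷ P → y′ ≤ _ → z′ < _
    bound (here refl) e≤x = above p (≤-<-trans e≤x x<y)
    bound (there p′) y′≤x = proj₁ (iso p′ p) (≤-<-trans y′≤x x<y)

  h-e : h e ≡ v
  h-e = ≤-antisym (step-≤ {(e , v) ∷ P} bound) (step-≥ {(e , v) ∷ P} (here refl) ≤-refl)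
    where
    bound : ∀ {y′ z′} → (y′ , z′) ∈ (e , v) ∷ P → y′ ≤ e → z′ ≤ v
    bound (here refl) _ = ≤-refl
    bound (there p′) y′≤e = below p′ (≤∧≢⇒< y′≤e (pair≢e p′))

  offset-≤ : ∀ x → offset x ≤ x
  offset-≤ x with x ∈? map proj₁ P
  ... | yes _ = z≤n
  ... | no _ = ≤-refl

  lift-∉ : ∀ {x} → x ∉ map proj₁ P → lift x ≡ B * h x + x
  lift-∉ {x} x∉ with x ∈? map proj₁ P
  ... | yes x∈ = ⊥-elim (x∉ x∈)
  ... | no _ = refl

  lift-pair : ∀ {y z} → (y , z) ∈ P → lift y ≡ B * z
  lift-pair {y} p with y ∈? map proj₁ P
  ... | yes _ = trans (+-identityʳ _) (cong (B *_) (h-pair p))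
  ... | no y∉ = ⊥-elim (y∉ (∈-map⁺ proj₁ p))

  lift-e : lift e ≡ B * v + e
  lift-e = trans (lift-∉ e∉) (cong (λ w → B * w + e) h-e)

  lift-≤ : ∀ x → lift x ≤ B * h x + x
  lift-≤ x = +-monoʳ-≤ (B * h x) (offset-≤ x)

  lift-increasing : ∀ {x y} → x < y → y < B → lift x < lift y
  lift-increasing {x} {y} x<y y<B = by-cases (y ∈? map proj₁ P)
    where
    open ≤-Reasoning
    by-cases : Dec (y ∈ map proj₁ P) → lift x < lift y
    by-cases (yes y∈) with ∈-map⁻ proj₁ y∈
    ... | (_ , z) , p , refl = begin-strict
      lift x      ≤⟨ lift-≤ x ⟩
      B * h x + x <⟨ digits-< (h-<-pair p x<y) (<-trans x<y y<B) ⟩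
      B * z       ≡⟨ sym (lift-pair p) ⟩
      lift y      ∎
    by-cases (no y∉) = begin-strict
      lift x      ≤⟨ lift-≤ x ⟩
      B * h x + x <⟨ +-mono-≤-< (*-monoʳ-≤ B (step-mono {(e , v) ∷ P} (<⇒≤ x<y))) x<y ⟩
      B * h y + y ≡⟨ sym (lift-∉ y∉) ⟩
      lift y      ∎

-- The m closed walks

module Extension {n k : ℕ} (k≤n : k ≤ n) {a : List ℕ} (perm : IsPerm n a) (G : ℕ → ℕ) where

  B : ℕ
  B = suc n

  seq : List ℕ
  seq = map (B *_) a ++ map G (drop (n ∸ k) a)

  private
    length-Ba : length (map (B *_) a) ≡ n
    length-Ba = trans (length-map (B *_) a) (perm-length perm)

    length-drop-1 : length (drop 1 a) ≡ n ∸ 1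
    length-drop-1 = trans (length-drop 1 a) (cong (_∸ 1) (perm-length perm))

    length-tail : length (drop (n ∸ k) a) ≡ k
    length-tail = trans (length-drop (n ∸ k) a) (trans (cong (_∸ (n ∸ k)) (perm-length perm)) (m∸[m∸n]≡n k≤n))

  seq-length : length seq ≡ n + k
  seq-length = trans (length-++ (map (B *_) a)) (cong₂ _+_ length-Ba (trans (length-map G (drop (n ∸ k) a)) length-tail))

  seq-unique : StrictlyIncreasingOn a G → (∀ {x y} → y ∈ drop (n ∸ k) a → G y ≢ B * x) → Unique seq
  seq-unique inc G≢B* =
    Unique.++⁺ (Unique.map⁺ (*-cancelˡ-≡ _ _ B) (perm-unique perm))
               (unique-map (increasingOn-⊆ inc (lookup (drop-⊆ (n ∸ k) a))) (Unique.drop⁺ (n ∸ k) (perm-unique perm)))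
               disjoint
    where
    disjoint : ∀ {w} → ¬ (w ∈ map (B *_) a × w ∈ map G (drop (n ∸ k) a))
    disjoint (w∈Ba , w∈GD) with ∈-map⁻ (B *_) w∈Ba | ∈-map⁻ G w∈GD
    ... | x , _ , refl | y , y∈ , Gy≡ = G≢B* y∈ (sym Gy≡)

  seq-start : st (take n seq) ≡ a
  seq-start = begin
    st (take n seq)                           ≡⟨ cong (λ m → st (take m seq)) (sym length-Ba) ⟩
    st (take (length (map (B *_) a)) seq)     ≡⟨ cong st (take-++-length (map (B *_) a) _) ⟩
    st (map (B *_) a)                         ≡⟨ st-map (λ _ _ → *-monoʳ-< B) ⟩
    st a                                      ≡⟨ st-perm perm ⟩
    a                                         ∎
    where open ≡-Reasoning

  seq-shift : StrictlyIncreasingOn a G → map G (take (n ∸ k) a) ≡ map (B *_) (drop k a) → st (take n (drop k seq)) ≡ a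
  seq-shift inc G-front = begin
    st (take n (drop k seq))                                   ≡⟨ cong (λ l → st (take n l)) drop-k-seq ⟩
    st (take n (map G a))                                      ≡⟨ cong st (take-all n (map G a) (≤-reflexive length-Ga)) ⟩
    st (map G a)                                               ≡⟨ st-map inc ⟩
    st a                                                       ≡⟨ st-perm perm ⟩
    a                                                          ∎
    where
    open ≡-Reasoning
    length-Ga : length (map G a) ≡ n
    length-Ga = trans (length-map G a) (perm-length perm)
    drop-k-seq : drop k seq ≡ map G a
    drop-k-seq = begin
      drop k seq                                             ≡⟨ drop-++-≤ k (map (B *_) a) _ (subst (k ≤_) (sym length-Ba) k≤n) ⟩
      drop k (map (B *_) a) ++ map G (drop (n ∸ k) a)        ≡⟨ cong (_++ map G (drop (n ∸ k) a)) (drop-map k a) ⟩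
      map (B *_) (drop k a) ++ map G (drop (n ∸ k) a)        ≡⟨ cong (_++ map G (drop (n ∸ k) a)) (sym G-front) ⟩
      map G (take (n ∸ k) a) ++ map G (drop (n ∸ k) a)       ≡⟨ sym (map-++ G (take (n ∸ k) a) _) ⟩
      map G (take (n ∸ k) a ++ drop (n ∸ k) a)               ≡⟨ cong (map G) (take++drop≡id (n ∸ k) a) ⟩
      map G a                                                ∎

  seq-second : 0 < k → take n (drop 1 seq) ≡ map (B *_) (drop 1 a) ∷ʳ G (a ! suc (n ∸ k))
  seq-second 0<k = begin
    take n (drop 1 seq)                     ≡⟨ cong (take n) drop-1-seq ⟩
    take n (xs ++ G e ∷ ys)                 ≡⟨ cong (λ m → take m (xs ++ G e ∷ ys)) n≡1+|xs| ⟩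
    take (suc (length xs)) (xs ++ G e ∷ ys) ≡⟨ take-suc-++ xs (G e) ys ⟩
    xs ∷ʳ G e                               ∎
    where
    open ≡-Reasoning
    e : ℕ
    e = a ! suc (n ∸ k)
    xs ys : List ℕ
    xs = map (B *_) (drop 1 a)
    ys = map G (drop (suc (n ∸ k)) a)
    0<n : 0 < n
    0<n = <-≤-trans 0<k k≤n
    n≡1+|xs| : n ≡ suc (length xs)
    n≡1+|xs| = begin
      n                       ≡⟨ sym (m+[n∸m]≡n {1} 0<n) ⟩
      suc (n ∸ 1)             ≡⟨ cong suc (sym (trans (length-map (B *_) (drop 1 a)) length-drop-1)) ⟩
      suc (length xs)         ∎
    drop-1-seq : drop 1 seq ≡ xs ++ G e ∷ ys
    drop-1-seq = begin
      drop 1 seq                                      ≡⟨ drop-++-≤ 1 (map (B *_) a) _ (subst (1 ≤_) (sym length-Ba) 0<n) ⟩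
      drop 1 (map (B *_) a) ++ map G (drop (n ∸ k) a)
        ≡⟨ cong₂ (λ l r → l ++ map G r) (drop-map 1 a) (drop-! (n ∸ k) a n∸k<|a|) ⟩
      xs ++ G e ∷ ys                                  ∎
      where
      n∸k<|a| : n ∸ k < length a
      n∸k<|a| = subst (n ∸ k <_) (sym (perm-length perm)) (∸-monoʳ-< {n} {k} {0} 0<k k≤n)

module Construction {n k m′ : ℕ} (0<k : 0 < k) (k≤n∸1 : k ≤ n ∸ 1)
  {a : List ℕ} (perm : IsPerm n a) (a-overlap : Overlap n k a a)
  {i j : ℕ} (k≤i : k ≤ i) (i≤n∸1 : i ≤ n ∸ 1) (k≤j : k ≤ j) (j≤n∸1 : j ≤ n ∸ 1)
  (ℓ : Fin m′ → ℕ) (ℓ-range : ∀ p → 1 ≤ ℓ p × ℓ p ≤ k ∸ 1)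
  (y-ℓ : ∀ p → st (drop 1 a) ! ℓ p ≡ st (drop 1 a) ! i + suc (toℕ p))
  (y-j : st (drop 1 a) ! j ≡ st (drop 1 a) ! i + suc m′)
  (z-lo : st (take (n ∸ k + 1) a) ! (i ∸ k + 1) + 1 ≡ st (take (n ∸ k + 1) a) ! (n ∸ k + 1))
  (z-hi : st (take (n ∸ k + 1) a) ! (j ∸ k + 1) ≡ st (take (n ∸ k + 1) a) ! (n ∸ k + 1) + 1)
  where

  B : ℕ
  B = suc n

  M Z front back : List ℕ
  M = drop 1 a
  Z = take (n ∸ k + 1) a
  front = take (n ∸ k) a
  back = drop k a

  P : List (ℕ × ℕ)
  P = zip front back

  -- st M is y_a and st Z is z_a; lo, e, hi are the letters behind z_{i−k+1}, z_{n−k+1}, z_{j−k+1}.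
  lo hi e : ℕ
  lo = a ! (i ∸ k + 1)
  hi = a ! (j ∸ k + 1)
  e = a ! (n ∸ k + 1)

  private
    k<n : k < n
    k<n = ≤∸1⇒< 0<k k≤n∸1

    n∸k<n : n ∸ k < n
    n∸k<n = ∸-monoʳ-< {n} {k} {0} 0<k (<⇒≤ k<n)

    t<n : ∀ {t} → k ≤ t → t ≤ n ∸ 1 → t < n
    t<n k≤t = ≤∸1⇒< (<-≤-trans 0<k k≤t)

    1≤u+1 : ∀ u → 1 ≤ u + 1
    1≤u+1 u = m≤n+m 1 u

    u+1≤ : ∀ {u v} → u < v → u + 1 ≤ v
    u+1≤ {u} {v} u<v = subst (_≤ v) (+-comm 1 u) u<v

    length-a : length a ≡ n
    length-a = perm-length perm

    length-M : length M ≡ n ∸ 1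
    length-M = trans (length-drop 1 a) (cong (_∸ 1) length-a)

    length-Z : length Z ≡ n ∸ k + 1
    length-Z = trans (length-take (n ∸ k + 1) a) (m≤n⇒m⊓n≡m (subst (n ∸ k + 1 ≤_) (sym length-a) (u+1≤ n∸k<n)))

    length-front : length front ≡ n ∸ k
    length-front = trans (length-take (n ∸ k) a) (m≤n⇒m⊓n≡m (subst (n ∸ k ≤_) (sym length-a) (<⇒≤ n∸k<n)))

    length-back : length back ≡ n ∸ k
    length-back = trans (length-drop k a) (cong (_∸ k) length-a)

  Z-entry : ∀ u → u ≤ n ∸ k → st Z ! (u + 1) ≡ suc (rank Z (a ! (u + 1)))
  Z-entry u u≤ = trans (st-! Z (1≤u+1 u) (subst (u + 1 ≤_) (sym length-Z) (+-monoˡ-≤ 1 u≤)))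
                       (cong (λ c → suc (rank Z c)) (!-take (n ∸ k + 1) a (1≤u+1 u) (+-monoˡ-≤ 1 u≤)))

  Z-∈ : ∀ u → u ≤ n ∸ k → a ! (u + 1) ∈ Z
  Z-∈ u u≤ = subst (_∈ Z) (!-take (n ∸ k + 1) a (1≤u+1 u) (+-monoˡ-≤ 1 u≤))
                   (!-∈ Z (1≤u+1 u) (subst (u + 1 ≤_) (sym length-Z) (+-monoˡ-≤ 1 u≤)))

  private
    i∸k≤ : i ∸ k ≤ n ∸ k
    i∸k≤ = ∸-monoˡ-≤ k (<⇒≤ (t<n k≤i i≤n∸1))

    j∸k≤ : j ∸ k ≤ n ∸ k
    j∸k≤ = ∸-monoˡ-≤ k (<⇒≤ (t<n k≤j j≤n∸1))

  rank-e≡suc-lo : rank Z e ≡ suc (rank Z lo)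
  rank-e≡suc-lo = suc-injective (begin
    suc (rank Z e)                ≡⟨ sym (Z-entry (n ∸ k) ≤-refl) ⟩
    st Z ! (n ∸ k + 1)            ≡⟨ sym z-lo ⟩
    st Z ! (i ∸ k + 1) + 1        ≡⟨ cong (_+ 1) (Z-entry (i ∸ k) i∸k≤) ⟩
    suc (rank Z lo) + 1           ≡⟨ +-comm _ 1 ⟩
    suc (suc (rank Z lo))         ∎)
    where open ≡-Reasoning

  rank-hi≡suc-e : rank Z hi ≡ suc (rank Z e)
  rank-hi≡suc-e = suc-injective (begin
    suc (rank Z hi)               ≡⟨ sym (Z-entry (j ∸ k) j∸k≤) ⟩
    st Z ! (j ∸ k + 1)            ≡⟨ z-hi ⟩
    st Z ! (n ∸ k + 1) + 1        ≡⟨ cong (_+ 1) (Z-entry (n ∸ k) ≤-refl) ⟩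
    suc (rank Z e) + 1            ≡⟨ +-comm _ 1 ⟩
    suc (suc (rank Z e))          ∎)
    where open ≡-Reasoning

  lo<e : lo < e
  lo<e = rank-reflects-< Z (subst (rank Z lo <_) (sym rank-e≡suc-lo) (n<1+n _))

  e<hi : e < hi
  e<hi = rank-reflects-< Z (subst (rank Z e <_) (sym rank-hi≡suc-e) (n<1+n _))

  front⊆Z : ∀ {y} → y ∈ front → y ∈ Z
  front⊆Z y∈ = lookup (take-⊆ (n ∸ k) Z) (subst (_ ∈_) (sym take-Z) y∈)
    where
    take-Z : take (n ∸ k) Z ≡ front
    take-Z = trans (take-take (n ∸ k) (n ∸ k + 1) a) (cong (λ t → take t a) (m≤n⇒m⊓n≡m (m≤m+n (n ∸ k) 1)))

  tail∩front : ∀ {y} → y ∈ drop (n ∸ k) a → y ∉ front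
  tail∩front y∈tail y∈front =
    unique-++-disjoint front (subst Unique (sym (take++drop≡id (n ∸ k) a)) (perm-unique perm)) y∈front y∈tail

  e∈tail : e ∈ drop (n ∸ k) a
  e∈tail = subst (e ∈_) (sym (drop-! (n ∸ k) a (subst (n ∸ k <_) (sym length-a) n∸k<n)))
                 (here (cong (a !_) (+-comm (n ∸ k) 1)))

  gap : ∀ {y} → y ∈ front → lo < y → y < hi → ⊥
  gap {y} y∈ lo<y y<hi with <-cmp y e
  ... | tri< y<e _ _ = rank-consecutive (Z-∈ (i ∸ k) i∸k≤) (front⊆Z y∈) rank-e≡suc-lo lo<y y<e
  ... | tri≈ _ refl _ = tail∩front e∈tail y∈
  ... | tri> _ _ e<y = rank-consecutive (Z-∈ (n ∸ k) ≤-refl) (front⊆Z y∈) rank-hi≡suc-e e<y y<hi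

  partner : ∀ {t} → k ≤ t → t ≤ n ∸ 1 → (a ! (t ∸ k + 1) , M ! t) ∈ P
  partner {t} k≤t t≤ =
    subst₂ (λ y z → (y , z) ∈ P) (!-take (n ∸ k) a (1≤u+1 (t ∸ k)) u≤)
      (trans (!-drop k a (1≤u+1 (t ∸ k))) (trans (cong (a !_) k+u≡1+t) (sym (!-drop 1 a 1≤t))))
      (!-zip front back (1≤u+1 (t ∸ k)) (subst (t ∸ k + 1 ≤_) (sym length-front) u≤)
                                        (subst (t ∸ k + 1 ≤_) (sym length-back) u≤))
    where
    1≤t : 1 ≤ t
    1≤t = <-≤-trans 0<k k≤t
    u≤ : t ∸ k + 1 ≤ n ∸ k
    u≤ = u+1≤ (∸-monoˡ-< (t<n k≤t t≤) k≤t)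
    k+u≡1+t : k + (t ∸ k + 1) ≡ 1 + t
    k+u≡1+t = trans (sym (+-assoc k (t ∸ k) 1)) (trans (cong (_+ 1) (m+[n∸m]≡n k≤t)) (+-comm t 1))

  iso : IsotonePairs P
  iso = isotone-zip (sym a-overlap)

  pos : ∀ {y z} → (y , z) ∈ P → 0 < z
  pos p = proj₁ (perm-∈ perm (lookup (drop-⊆ k a) (proj₂ (zip-∈ p))))

  ∉front⇒∉P : ∀ {y} → y ∉ front → y ∉ map proj₁ P
  ∉front⇒∉P y∉ y∈ with ∈-map⁻ proj₁ y∈
  ... | _ , p , refl = y∉ (proj₁ (zip-∈ p))

  M-entry : ∀ {t} → 1 ≤ t → t ≤ n ∸ 1 → st M ! t ≡ suc (rank M (M ! t))
  M-entry 1≤t t≤ = st-! M 1≤t (subst (_ ≤_) (sym length-M) t≤)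

  M-∈ : ∀ {t} → 1 ≤ t → t ≤ n ∸ 1 → M ! t ∈ M
  M-∈ 1≤t t≤ = !-∈ M 1≤t (subst (_ ≤_) (sym length-M) t≤)

  index : Fin (suc m′) → ℕ
  index Fin.zero = i
  index (Fin.suc p) = ℓ p

  index-range : ∀ q → 1 ≤ index q × index q ≤ n ∸ 1
  index-range Fin.zero = <-≤-trans 0<k k≤i , i≤n∸1
  index-range (Fin.suc p) = proj₁ (ℓ-range p) , ≤-trans (proj₂ (ℓ-range p)) (∸-monoˡ-≤ 1 (<⇒≤ k<n))

  v : Fin (suc m′) → ℕ
  v q = M ! index q

  v∈M : ∀ q → v q ∈ M
  v∈M q = M-∈ (proj₁ (index-range q)) (proj₂ (index-range q))

  y-v : ∀ q → st M ! index q ≡ suc (rank M (v q))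
  y-v q = M-entry (proj₁ (index-range q)) (proj₂ (index-range q))

  rank-v : ∀ q → rank M (v q) ≡ rank M (M ! i) + toℕ q
  rank-v Fin.zero = sym (+-identityʳ _)
  rank-v (Fin.suc p) = suc-injective (begin
    suc (rank M (v (Fin.suc p)))          ≡⟨ sym (y-v (Fin.suc p)) ⟩
    st M ! ℓ p                            ≡⟨ y-ℓ p ⟩
    st M ! i + suc (toℕ p)                ≡⟨ cong (_+ suc (toℕ p)) (y-v Fin.zero) ⟩
    suc (rank M (M ! i)) + suc (toℕ p)    ∎)
    where open ≡-Reasoning

  rank-M!j : rank M (M ! j) ≡ rank M (M ! i) + suc m′
  rank-M!j = suc-injective (begin
    suc (rank M (M ! j))                  ≡⟨ sym (M-entry (<-≤-trans 0<k k≤j) j≤n∸1) ⟩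
    st M ! j                              ≡⟨ y-j ⟩
    st M ! i + suc m′                     ≡⟨ cong (_+ suc m′) (y-v Fin.zero) ⟩
    suc (rank M (M ! i)) + suc m′         ∎)
    where open ≡-Reasoning

  M!i≤v : ∀ q → M ! i ≤ v q
  M!i≤v q = rank-reflects-≤ (v∈M q) (subst (rank M (M ! i) ≤_) (sym (rank-v q)) (m≤m+n _ _))

  v<M!j : ∀ q → v q < M ! j
  v<M!j q = rank-reflects-< M (subst₂ _<_ (sym (rank-v q)) (sym rank-M!j) (+-monoʳ-< _ (toℕ<n q)))

  below : ∀ q {y z} → (y , z) ∈ P → y < e → z ≤ v q
  below q p y<e = ≤-trans (isotone-≤ iso p (partner k≤i i≤n∸1) y≤lo) (M!i≤v q)
    where
    y≤lo = ≮⇒≥ (λ lo<y → gap (proj₁ (zip-∈ p)) lo<y (<-trans y<e e<hi))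

  above : ∀ q {y z} → (y , z) ∈ P → e < y → v q < z
  above q p e<y = <-≤-trans (v<M!j q) (isotone-≤ iso (partner k≤j j≤n∸1) p hi≤y)
    where
    hi≤y = ≮⇒≥ (λ y<hi → gap (proj₁ (zip-∈ p)) (<-trans lo<e e<y) y<hi)

  e∉P : e ∉ map proj₁ P
  e∉P = ∉front⇒∉P (tail∩front e∈tail)

  module Lift (q : Fin (suc m′)) = Insertion P iso pos e∉P (below q) (above q) B

  G : Fin (suc m′) → ℕ → ℕ
  G q = Lift.lift q

  G-increasing : ∀ q → StrictlyIncreasingOn a (G q)
  G-increasing q _ y∈ x<y = Lift.lift-increasing q x<y (proj₂ (perm-∈ perm y∈))

  G-front : ∀ q → map (G q) front ≡ map (B *_) back
  G-front q = zip-map≡ front back (trans length-front (sym length-back)) (Lift.lift-pair q)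

  G-tail : ∀ q {x y} → y ∈ drop (n ∸ k) a → G q y ≢ B * x
  G-tail q {x} {y} y∈ = subst (_≢ B * x) (sym (Lift.lift-∉ q (∉front⇒∉P (tail∩front y∈))))
                              (digits-≢ (proj₁ y-bounds) (proj₂ y-bounds))
    where
    y-bounds = perm-∈ perm (lookup (drop-⊆ (n ∸ k) a) y∈)

  module Seq (q : Fin (suc m′)) = Extension (<⇒≤ k<n) perm (G q)

  seq : Fin (suc m′) → List ℕ
  seq q = Seq.seq q

  closedWalk : ∀ q → ClosedWalk n k (a ∷ windows n (drop 1 (seq q)) (k ∸ 1))
  closedWalk q = closedWalk-windows 0<k
    (Seq.seq-unique q (G-increasing q) (G-tail q)) (≤-reflexive (sym (Seq.seq-length q)))
    (Seq.seq-start q) (Seq.seq-shift q (G-increasing q) (G-front q))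

  secondVertex-last : ∀ q → Σ (List ℕ) λ xs → st (take n (drop 1 (seq q))) ≡ xs ∷ʳ suc (rank M (suc (v q)))
  secondVertex-last q = prefix , (begin
    st (take n (drop 1 (seq q)))                  ≡⟨ cong st (Seq.seq-second q 0<k) ⟩
    st (map (B *_) M ∷ʳ G q e′)                   ≡⟨ st-∷ʳ (map (B *_) M) (G q e′) ⟩
    prefix ∷ʳ suc (rank (map (B *_) M) (G q e′))  ≡⟨ cong (λ c → prefix ∷ʳ suc (rank (map (B *_) M) c)) G-e′ ⟩
    prefix ∷ʳ suc (rank (map (B *_) M) (B * v q + e))
                                                  ≡⟨ cong (λ r → prefix ∷ʳ suc r) (rank-digits M (proj₁ e-bounds) (proj₂ e-bounds)) ⟩
    prefix ∷ʳ suc (rank M (suc (v q)))            ∎)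
    where
    open ≡-Reasoning
    e′ : ℕ
    e′ = a ! suc (n ∸ k)
    prefix : List ℕ
    prefix = map (λ c → suc (rank (map (B *_) M ∷ʳ G q e′) c)) (map (B *_) M)
    G-e′ : G q e′ ≡ B * v q + e
    G-e′ = trans (cong (G q) (cong (a !_) (+-comm 1 (n ∸ k)))) (Lift.lift-e q)
    e-bounds = perm-∈ perm (lookup (drop-⊆ (n ∸ k) a) e∈tail)

  secondVertex-injective : ∀ p q → st (take n (drop 1 (seq p))) ≡ st (take n (drop 1 (seq q))) → p ≡ q
  secondVertex-injective p q same = toℕ-injective (+-cancelˡ-≡ (rank M (M ! i)) _ _ (begin
    rank M (M ! i) + toℕ p  ≡⟨ sym (rank-v p) ⟩
    rank M (v p)            ≡⟨ cong (rank M) v-p≡v-q ⟩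
    rank M (v q)            ≡⟨ rank-v q ⟩
    rank M (M ! i) + toℕ q  ∎))
    where
    open ≡-Reasoning
    last≡ : suc (rank M (suc (v p))) ≡ suc (rank M (suc (v q)))
    last≡ = ∷ʳ-injectiveʳ (proj₁ (secondVertex-last p)) (proj₁ (secondVertex-last q))
      (trans (sym (proj₂ (secondVertex-last p))) (trans same (proj₂ (secondVertex-last q))))
    v-p≡v-q : v p ≡ v q
    v-p≡v-q = increasingOn-injective (rank-suc-increasing M) (v∈M p) (v∈M q) (suc-injective last≡)

theorem3p10 : (n k m : ℕ) → 2 ≤ k → k ≤ n ∸ 1 → 2 ≤ m → m ≤ k →
    (a : List ℕ) → Vertex n a →
    Σ (List (List ℕ)) (λ ws → ClosedWalk n k ws × a ∈ ws) →
    (i j : ℕ) → k ≤ i → i ≤ n ∸ 1 → k ≤ j → j ≤ n ∸ 1 →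
    (ℓ : Fin (m ∸ 1) → ℕ) → (∀ p → 1 ≤ ℓ p × ℓ p ≤ k ∸ 1) →
    (∀ p → st (drop 1 a) ! ℓ p ≡ st (drop 1 a) ! i + suc (toℕ p)) →
    st (drop 1 a) ! j ≡ st (drop 1 a) ! i + m →
    st (take (n ∸ k + 1) a) ! (i ∸ k + 1) + 1 ≡ st (take (n ∸ k + 1) a) ! (n ∸ k + 1) →
    st (take (n ∸ k + 1) a) ! (j ∸ k + 1) ≡ st (take (n ∸ k + 1) a) ! (n ∸ k + 1) + 1 →
    Σ (Fin m → List ℕ) λ b → Σ (Fin m → List (List ℕ)) λ r →
      (∀ p → ClosedWalk n k (a ∷ b p ∷ r p)) × (∀ p q → b p ≡ b q → p ≡ q)
theorem3p10 n (suc (suc k″)) (suc m′) (s≤s (s≤s z≤n)) k≤n∸1 (s≤s (s≤s z≤n)) _ a perm (_ , walk , a∈ws)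
            i j k≤i i≤n∸1 k≤j j≤n∸1 ℓ ℓ-range y-ℓ y-j z-lo z-hi =
  (λ q → st (take n (drop 1 (seq q)))) , (λ q → windows n (drop 1 (drop 1 (seq q))) k″) ,
  closedWalk , secondVertex-injective
  where
  open Construction (s≤s z≤n) k≤n∸1 perm (closedWalk-overlap walk a∈ws)
                    k≤i i≤n∸1 k≤j j≤n∸1 ℓ ℓ-range y-ℓ y-j z-lo z-hi
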